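{- Let $A\in\mathbb{Z}^{m\times n}$ with bouquet matrix $A_B\in\mathbb{Z}^{m\times q}$ and isomorphism $D:\operatorname{Ker}_{\mathbb{Z}}(A_B)\to\operatorname{Ker}_{\mathbb{Z}}(A)$ as in the context. Suppose $\operatorname{Ker}_{\mathbb{Z}}(A_B)\cap\mathbb{N}^q=\{\mathbf{0}\}$. If $\mathbf{u}$ is an indispensable element of $A_B$, then $D(\mathbf{u})$ is an indispensable element of $A$.
   Context: For an integer matrix $M$ with $N$ columns, a Markov basis of $M$ is a finite set $\mathcal{M}\subseteq\operatorname{Ker}_{\mathbb{Z}}(M)$ such that whenever $\mathbf{w},\mathbf{u}\in\mathbb{N}^N$ with $\mathbf{w}-\mathbf{u}\in\operatorname{Ker}_{\mathbb{Z}}(M)$, there exist $\mathbf{v}_1,\ldots,\mathbf{v}_p\in\mathcal{M}\cup(-\mathcal{M})$ with $\mathbf{w}-\sum_{i=1}^l\mathbf{v}_i\in\mathbb{N}^N$ for all $1\le l\le p$ and $\mathbf{w}-\mathbf{u}=\sum_{i=1}^p\mathbf{v}_i$. It is minimal if no proper subset is a Markov basis. An element of $\operatorname{Ker}_{\mathbb{Z}}(M)$ is indispensable if it (up to sign) belongs to every minimal Markov basis of $M$. Bouquets. Let $A=[\mathbf{a}_1,\ldots,\mathbf{a}_n]\in\mathbb{Z}^{m\times n}$. Fix a matrix whose columns form a $\mathbb{Z}$-basis of $\operatorname{Ker}_{\mathbb{Z}}(A)$, and let the Gale transform $G(\mathbf{a}_i)$ be its $i$-th row. Call $i\neq j$ adjacent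 if there is $\mathbf{v}\in\mathbb{Z}^m$ such that $\mathbf{v}\cdot A$ has nonzero entries exactly in positions $i$ and $j$; the bouquets of $A$ are the classes of the equivalence relation on the columns generated by adjacency. A bouquet is free if $G(\mathbf{a}_i)=\mathbf{0}$ for its columns; otherwise it is non-free, and then all $G(\mathbf{a}_i)$, $\mathbf{a}_i\in B$, are nonzero and pairwise linearly dependent. For each bouquet $B$ define $\mathbf{c}_B\in\mathbb{Z}^n$: if $B$ is free, $\mathbf{c}_B$ is any nonzero vector with support $\{i:\mathbf{a}_i\in B\}$ whose first nonzero coordinate is positive; if $B$ is non-free, pick a coordinate $j$ with $G(\mathbf{a}_i)_j\neq0$ for all $\mathbf{a}_i\in B$, let $g=\gcd(G(\mathbf{a}_i)_j:\mathbf{a}_i\in B)$, let $i_0$ be the smallest index with $\mathbf{a}_{i_0}\in B$, let $\varepsilon$ be the sign of $G(\mathbf{a}_{i_0})_j$, and set $(\mathbf{c}_B)_i=\varepsilon G(\mathbf{a}_i)_j/g$ if $\mathbf{a}_i\in B$ and $0$ otherwise. Set $\mathbf{a}_B=\sum_{i=1}^n(\mathbf{c}_B)_i\mathbf{a}_i$. If $B_1,\ldots,B_q$ are the bouquets of $A$, the bouquet matrix is $A_B=[\mathbf{a}_{B_1},\ldots,\mathbf{a}_{B_q}]\in\mathbb{Z}^{m\times q}$. The map $D:\operatorname{Ker}_{\mathbb{Z}}(A_B)\to\operatorname{Ker}_{\mathbb{Z}}(A)$, $D(u_1,\ldots,u_q)=\sum_k u_k\mathbf{c}_{B_k}$, is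 a (known) isomorphism. -}

module Defs where

open import Data.Nat as ℕ using (ℕ; zero; suc)
open import Data.Nat.GCD using (gcd)
open import Data.Integer using (ℤ; +_; -[1+_]; _+_; _-_; _*_; -_; ∣_∣; _≤_; _<_; 0ℤ; 1ℤ)
open import Data.Fin as Fin using (Fin)
open import Data.Vec using (Vec; []; _∷_; lookup; tabulate; zipWith; replicate; map; foldr)
open import Data.List as List using (List)
open import Data.List.Membership.Propositional using (_∈_)
open import Data.List.Relation.Binary.Subset.Propositional using (_⊆_)
open import Data.List.Relation.Unary.All using (All)
open import Data.Product using (_×_; ∃; ∃-syntax; Σ-syntax)
open import Data.Sum using (_⊎_)
open import Data.Unit using (⊤)
open import Data.Bool using (if_then_else_)
open import Relation.Nullary using (¬_)
open import Relation.Nullary.Decidable using (⌊_⌋)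
open import Relation.Binary.PropositionalEquality using (_≡_; _≢_)
open import Relation.Binary.Construct.Closure.Equivalence using (EqClosure)

∑ : ∀ {n} → (Fin n → ℤ) → ℤ
∑ {zero}  f = 0ℤ
∑ {suc n} f = f Fin.zero + ∑ (λ i → f (Fin.suc i))

gcdOver : ∀ {n} → (Fin n → ℕ) → ℕ
gcdOver {zero}  f = 0
gcdOver {suc n} f = gcd (f Fin.zero) (gcdOver (λ i → f (Fin.suc i)))

Mat : ℕ → ℕ → Set
Mat m n = Vec (Vec ℤ n) m

entry : ∀ {m n} → Mat m n → Fin m → Fin n → ℤ
entry M i j = lookup (lookup M i) j

zeros : ∀ {n} → Vec ℤ n
zeros = replicate _ 0ℤ

_⊕_ : ∀ {n} → Vec ℤ n → Vec ℤ n → Vec ℤ n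
_⊕_ = zipWith _+_

_⊖_ : ∀ {n} → Vec ℤ n → Vec ℤ n → Vec ℤ n
_⊖_ = zipWith _-_

neg : ∀ {n} → Vec ℤ n → Vec ℤ n
neg = map (λ x → - x)

sumV : ∀ {n} → List (Vec ℤ n) → Vec ℤ n
sumV = List.foldr _⊕_ zeros

_·ᵥ_ : ∀ {m n} → Mat m n → Vec ℤ n → Vec ℤ m
M ·ᵥ u = tabulate λ i → ∑ λ j → entry M i j * lookup u j

_ᵥ·_ : ∀ {m n} → Vec ℤ m → Mat m n → Vec ℤ n
v ᵥ· M = tabulate λ j → ∑ λ i → lookup v i * entry M i j

column : ∀ {m n} → Mat m n → Fin n → Vec ℤ m
column M j = tabulate λ i → entry M i j

InKer : ∀ {m n} → Mat m n → Vec ℤ n → Set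
InKer M u = M ·ᵥ u ≡ zeros

NonNeg : ∀ {n} → Vec ℤ n → Set
NonNeg u = ∀ i → 0ℤ ≤ lookup u i

StaysNonNeg : ∀ {N} → Vec ℤ N → List (Vec ℤ N) → Set
StaysNonNeg w List.[] = ⊤
StaysNonNeg w (v List.∷ vs) = NonNeg (w ⊖ v) × StaysNonNeg (w ⊖ v) vs

IsMarkovBasis : ∀ {m N} → Mat m N → List (Vec ℤ N) → Set
IsMarkovBasis M 𝓜 =
  (∀ v → v ∈ 𝓜 → InKer M v) ×
  (∀ w u → NonNeg w → NonNeg u → InKer M (w ⊖ u) →
     ∃[ vs ] (All (λ v → v ∈ 𝓜 ⊎ neg v ∈ 𝓜) vs ×
              StaysNonNeg w vs ×
              (w ⊖ u ≡ sumV vs)))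

IsMinimalMarkovBasis : ∀ {m N} → Mat m N → List (Vec ℤ N) → Set
IsMinimalMarkovBasis M 𝓜 =
  IsMarkovBasis M 𝓜 ×
  (∀ 𝓜′ → 𝓜′ ⊆ 𝓜 → IsMarkovBasis M 𝓜′ → 𝓜 ⊆ 𝓜′)

Indispensable : ∀ {m N} → Mat m N → Vec ℤ N → Set
Indispensable M u =
  InKer M u ×
  (∀ 𝓜 → IsMinimalMarkovBasis M 𝓜 → u ∈ 𝓜 ⊎ neg u ∈ 𝓜)

-- The columns of the n × r matrix Gm form a ℤ-basis of Ker_ℤ(A);
-- the Gale transform G(a_i) is then the i-th row  lookup Gm i.
IsKerBasis : ∀ {m n r} → Mat m n → Mat n r → Set
IsKerBasis A Gm =
  (∀ t → InKer A (column Gm t)) ×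
  (∀ λs → Gm ·ᵥ λs ≡ zeros → λs ≡ zeros) ×
  (∀ u → InKer A u → ∃[ λs ] (Gm ·ᵥ λs ≡ u))

Adjacent : ∀ {m n} → Mat m n → Fin n → Fin n → Set
Adjacent A i j =
  i ≢ j ×
  ∃[ v ] (lookup (v ᵥ· A) i ≢ 0ℤ × lookup (v ᵥ· A) j ≢ 0ℤ ×
          (∀ k → k ≢ i → k ≢ j → lookup (v ᵥ· A) k ≡ 0ℤ))

-- β : Fin n → Fin q labels the bouquets B₁,…,B_q: every label is used and
-- two columns have the same label iff they are related by the equivalence
-- relation generated by adjacency.  (Bouquet k is  { i ∣ β i ≡ k }.)
IsBouquetLabelling : ∀ {m n q} → Mat m n → (Fin n → Fin q) → Set
IsBouquetLabelling A β =
  (∀ k → ∃[ i ] (β i ≡ k)) ×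
  (∀ i j → (β i ≡ β j → EqClosure (Adjacent A) i j) ×
           (EqClosure (Adjacent A) i j → β i ≡ β j))

IsFree : ∀ {n q r} → Mat n r → (Fin n → Fin q) → Fin q → Set
IsFree Gm β k = ∀ i → β i ≡ k → lookup Gm i ≡ zeros

IsFirstOf : ∀ {n q} → (Fin n → Fin q) → Fin q → Fin n → Set
IsFirstOf β k i₀ = β i₀ ≡ k × (∀ i → β i ≡ k → i₀ Fin.≤ i)

sgn : ℤ → ℤ
sgn (+ zero)  = 0ℤ
sgn (+ suc _) = 1ℤ
sgn -[1+ _ ]  = -[1+ 0 ]

bouquetGcd : ∀ {n q r} → Mat n r → (Fin n → Fin q) → Fin q → Fin r → ℕ
bouquetGcd Gm β k j =
  gcdOver λ i → if ⌊ β i Fin.≟ k ⌋ then ∣ entry Gm i j ∣ else 0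

IsBouquetVector : ∀ {n q r} → Mat n r → (Fin n → Fin q) → Fin q → Vec ℤ n → Set
IsBouquetVector Gm β k c =
  (IsFree Gm β k ×
   (∃[ i ] (lookup c i ≢ 0ℤ)) ×
   (∀ i → (lookup c i ≢ 0ℤ → β i ≡ k) × (β i ≡ k → lookup c i ≢ 0ℤ)) ×
   (∀ i → lookup c i ≢ 0ℤ → (∀ i′ → i′ Fin.< i → lookup c i′ ≡ 0ℤ) →
      0ℤ < lookup c i))
  ⊎
  -- non-free bouquet: for some coordinate j nonzero on all of B_k,
  -- (c)_i = ε G(a_i)_j / g on B_k and 0 elsewhere
  (¬ IsFree Gm β k ×
   ∃[ j ] ((∀ i → β i ≡ k → entry Gm i j ≢ 0ℤ) ×
           (∀ i₀ → IsFirstOf β k i₀ → ∀ i →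
              (β i ≡ k → lookup c i * + bouquetGcd Gm β k j
                           ≡ sgn (entry Gm i₀ j) * entry Gm i j) ×
              (¬ β i ≡ k → lookup c i ≡ 0ℤ))))

bouquetMatrix : ∀ {m n q} → Mat m n → (Fin q → Vec ℤ n) → Mat m q
bouquetMatrix A c = tabulate λ l → tabulate λ k → ∑ λ i → lookup (c k) i * entry A l i

Dmap : ∀ {n q} → (Fin q → Vec ℤ n) → Vec ℤ q → Vec ℤ n
Dmap c u = tabulate λ i → ∑ λ k → lookup u k * lookup (c k) i

-- Adjacent columns of A have proportional kernel coordinates, so on each bouquet B a kernel
-- element of A is proportional to c_B; as c_B is primitive there, it is an integer multiple
-- of c_B, and D is onto.  Every bouquet has a column with positive coefficient in c_B, so a
-- walk through nonnegative vectors in a fibre of A pulls back along D to one of A_B.  Hence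
-- a minimal Markov basis 𝓜 of A pulls back to a Markov basis of A_B.  That contains a minimal
-- Markov basis, which contains ±u, so ±D(u) lies in 𝓜.
module Submission where

open import Defs
open import Algebra.Properties.Semiring.Sum as Sum using ()
open import Data.Bool using (if_then_else_)
open import Data.Empty using (⊥-elim)
open import Data.Fin as Fin using (Fin; zero; suc)
import Data.Fin.Properties as FinP
open import Data.Integer as ℤ using (ℤ; +_; +0; -[1+_]; +[1+_]; _+_; _-_; _*_; -_; 0ℤ; 1ℤ; ∣_∣)
import Data.Integer.Divisibility.Signed as ℤD
import Data.Integer.Properties as ℤP
open import Data.Integer.Tactic.RingSolver using (solve-∀)
open import Data.List as List using (List; length; filter)
open import Data.List.Membership.Propositional using (_∈_)
open import Data.List.Membership.Propositional.Properties using (∈-map⁺; ∈-map⁻; ∈-filter⁺)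
open import Data.List.Membership.DecPropositional as DecMembership using ()
open import Data.List.Properties using (filter-notAll)
open import Data.List.Relation.Binary.Subset.Propositional using (_⊆_)
open import Data.List.Relation.Binary.Subset.Propositional.Properties using (filter-⊆)
import Data.List.Relation.Binary.Subset.DecPropositional as DecSubset
open import Data.List.Relation.Unary.All as All using (All; []; _∷_)
open import Data.List.Relation.Unary.All.Properties using (¬All⇒Any¬; map⁺)
open import Data.Nat as ℕ using (ℕ)
import Data.Nat.Divisibility as ℕD
open import Data.Nat.GCD using (gcd; c*gcd[m,n]≡gcd[cm,cn]; gcd-greatest)
open import Data.Nat.Induction using (<-wellFounded)
import Data.Nat.Properties as ℕP
open import Data.Product using (_×_; _,_; proj₁; proj₂; ∃; ∃₂; ∃-syntax)
open import Data.Sum using (_⊎_; inj₁; inj₂; [_,_])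
open import Data.Unit using (tt)
open import Data.Vec using (Vec; lookup; tabulate)
open import Data.Vec.Properties
  using (≡-dec; lookup∘tabulate; tabulate∘lookup; tabulate-cong; lookup-zipWith; lookup-replicate; lookup-map)
open import Function using (_∘_; _on_; id)
open import Induction.WellFounded using (Acc; acc)
open import Relation.Binary.Construct.Closure.Equivalence using (EqClosure; fold)
open import Relation.Binary.Construct.On as On using ()
open import Relation.Binary.PropositionalEquality
  using (_≡_; _≢_; refl; sym; trans; cong; cong₂; subst; subst₂; module ≡-Reasoning)
open import Relation.Binary.Structures using (IsEquivalence)
open import Relation.Nullary using (¬_; Dec; yes; no; does)
open import Relation.Nullary.Decidable using (⌊_⌋; ¬?; decidable-stable; _⊎-dec_)
open import Relation.Nullary.Negation using (¬¬-map)
open import Relation.Unary using (Pred; Decidable)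

open Sum ℤP.+-*-semiring using (sum; sum-cong-≗; sum-replicate-zero; ∑-comm; ∑-distrib-+; *-distribˡ-sum; *-distribʳ-sum)
open ≡-Reasoning

lookup-ext : ∀ {a} {A : Set a} {n} {u v : Vec A n} → (∀ i → lookup u i ≡ lookup v i) → u ≡ v
lookup-ext {u = u} {v} eq = trans (sym (tabulate∘lookup u)) (trans (tabulate-cong eq) (tabulate∘lookup v))

least-witness : ∀ {p n} {P : Pred (Fin n) p} → Decidable P → ∃ P → ∃[ i ] (P i × ∀ j → P j → i Fin.≤ j)
least-witness {n = ℕ.suc n} P? witness with P? zero
... | yes P0 = zero , P0 , λ _ _ → ℕ.z≤n
... | no ¬P0 with witness
...   | zero , P0 = ⊥-elim (¬P0 P0)
...   | suc i , Pi with least-witness (P? ∘ suc) (i , Pi)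
...     | i′ , Pi′ , i′-least = suc i′ , Pi′ , λ { zero P0 → ⊥-elim (¬P0 P0) ; (suc j) Pj → ℕ.s≤s (i′-least j Pj) }

*-≢0 : ∀ {i j} → i ≢ 0ℤ → j ≢ 0ℤ → i * j ≢ 0ℤ
*-≢0 {i} i≢0 j≢0 ij≡0 = [ i≢0 , j≢0 ] (ℤP.i*j≡0⇒i≡0∨j≡0 i ij≡0)

*-cancelʳ-≢0 : ∀ {i j k} → k ≢ 0ℤ → i * k ≡ j * k → i ≡ j
*-cancelʳ-≢0 {i} {j} {k} k≢0 = ℤP.*-cancelʳ-≡ i j k {{ℤ.≢-nonZero k≢0}}

-‿≢0 : ∀ {i} → i ≢ 0ℤ → - i ≢ 0ℤ
-‿≢0 {i} i≢0 -i≡0 = i≢0 (trans (sym (ℤP.neg-involutive i)) (cong -_ -i≡0))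

0≤i⇒0≤j⇒0≤i*j : ∀ {i j} → 0ℤ ℤ.≤ i → 0ℤ ℤ.≤ j → 0ℤ ℤ.≤ i * j
0≤i⇒0≤j⇒0≤i*j {+ m} {+ n} _ _ = subst (0ℤ ℤ.≤_) (ℤP.pos-* m n) (ℤ.+≤+ ℕ.z≤n)

0<j⇒0≤i*j⇒0≤i : ∀ {i j} → 0ℤ ℤ.< j → 0ℤ ℤ.≤ i * j → 0ℤ ℤ.≤ i
0<j⇒0≤i*j⇒0≤i {i} {j} 0<j = ℤP.*-cancelʳ-≤-pos 0ℤ i j {{ℤ.positive 0<j}}

i≢0⇒0<+∣i∣ : ∀ {i} → i ≢ 0ℤ → 0ℤ ℤ.< + ∣ i ∣
i≢0⇒0<+∣i∣ i≢0 = ℤ.+<+ (ℕP.n≢0⇒n>0 (i≢0 ∘ ℤP.∣i∣≡0⇒i≡0))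

cross-multiply : ∀ α α′ a b a′ b′ → α ≢ 0ℤ →
                 α * a ≡ α′ * b → α * a′ ≡ α′ * b′ → a * b′ ≡ b * a′
cross-multiply α α′ a b a′ b′ α≢0 eq eq′ = *-cancelʳ-≢0 α≢0 (begin
  a * b′ * α    ≡⟨ swap₁ a b′ α ⟩
  α * a * b′    ≡⟨ cong (_* b′) eq ⟩
  α′ * b * b′   ≡⟨ swap₂ α′ b b′ ⟩
  b * (α′ * b′) ≡⟨ cong (b *_) eq′ ⟨
  b * (α * a′)  ≡⟨ swap₃ b α a′ ⟩
  b * a′ * α    ∎)
  where
  swap₁ : ∀ x y z → x * y * z ≡ z * x * y
  swap₁ = solve-∀
  swap₂ : ∀ x y z → x * y * z ≡ y * (x * z)
  swap₂ = solve-∀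
  swap₃ : ∀ x y z → x * (y * z) ≡ x * z * y
  swap₃ = solve-∀

sgn-≢0 : ∀ {i} → i ≢ 0ℤ → sgn i ≢ 0ℤ
sgn-≢0 {+[1+ _ ]} _ ()
sgn-≢0 { -[1+ _ ]} _ ()
sgn-≢0 {+0} i≢0 = ⊥-elim (i≢0 refl)

sgn*i≡+∣i∣ : ∀ i → sgn i * i ≡ + ∣ i ∣
sgn*i≡+∣i∣ +0       = refl
sgn*i≡+∣i∣ +[1+ n ] = ℤP.*-identityˡ +[1+ n ]
sgn*i≡+∣i∣ -[1+ n ] = ℤP.-1*i≡-i -[1+ n ]

∣sgn[j]*i∣≡∣i∣ : ∀ {j} → j ≢ 0ℤ → ∀ i → ∣ sgn j * i ∣ ≡ ∣ i ∣
∣sgn[j]*i∣≡∣i∣ {+[1+ _ ]} _ i = cong ∣_∣ (ℤP.*-identityˡ i)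
∣sgn[j]*i∣≡∣i∣ { -[1+ _ ]} _ i = trans (cong ∣_∣ (ℤP.-1*i≡-i i)) (ℤP.∣-i∣≡∣i∣ i)
∣sgn[j]*i∣≡∣i∣ {+0} j≢0 = ⊥-elim (j≢0 refl)

∑≡sum : ∀ {n} (f : Fin n → ℤ) → ∑ f ≡ sum f
∑≡sum {ℕ.zero}  f = refl
∑≡sum {ℕ.suc n} f = cong (_+_ (f zero)) (∑≡sum (f ∘ suc))

sum-neg : ∀ {n} (f : Fin n → ℤ) → sum (λ i → - f i) ≡ - sum f
sum-neg f = begin
  sum (λ i → - f i)        ≡⟨ sum-cong-≗ (λ i → ℤP.-1*i≡-i (f i)) ⟨
  sum (λ i → -[1+ 0 ] * f i) ≡⟨ *-distribˡ-sum -[1+ 0 ] f ⟨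
  -[1+ 0 ] * sum f         ≡⟨ ℤP.-1*i≡-i (sum f) ⟩
  - sum f                  ∎

sum-single : ∀ {n} (f : Fin n → ℤ) i → (∀ j → j ≢ i → f j ≡ 0ℤ) → sum f ≡ f i
sum-single {ℕ.suc n} f zero f≡0 = begin
  f zero + sum (f ∘ suc) ≡⟨ cong (_+_ (f zero)) (sum-cong-≗ (λ j → f≡0 (suc j) λ ())) ⟩
  f zero + sum {n} (λ _ → 0ℤ) ≡⟨ cong (_+_ (f zero)) (sum-replicate-zero n) ⟩
  f zero + 0ℤ            ≡⟨ ℤP.+-identityʳ (f zero) ⟩
  f zero                 ∎
sum-single f (suc i) f≡0 = begin
  f zero + sum (f ∘ suc) ≡⟨ cong₂ _+_ (f≡0 zero λ ())
                              (sum-single (f ∘ suc) i (λ j j≢i → f≡0 (suc j) (j≢i ∘ FinP.suc-injective))) ⟩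
  0ℤ + f (suc i)         ≡⟨ ℤP.+-identityˡ (f (suc i)) ⟩
  f (suc i)              ∎

sum-pair : ∀ {n} (f : Fin n → ℤ) {i j} → i ≢ j → (∀ k → k ≢ i → k ≢ j → f k ≡ 0ℤ) → sum f ≡ f i + f j
sum-pair f {zero} {zero} i≢j _ = ⊥-elim (i≢j refl)
sum-pair f {zero} {suc j} _ f≡0 =
  cong (_+_ (f zero)) (sum-single (f ∘ suc) j (λ k k≢j → f≡0 (suc k) (λ ()) (k≢j ∘ FinP.suc-injective)))
sum-pair f {suc i} {zero} _ f≡0 = trans
  (cong (_+_ (f zero)) (sum-single (f ∘ suc) i (λ k k≢i → f≡0 (suc k) (k≢i ∘ FinP.suc-injective) (λ ()))))
  (ℤP.+-comm (f zero) (f (suc i)))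
sum-pair f {suc i} {suc j} i≢j f≡0 = trans
  (cong₂ _+_ (f≡0 zero (λ ()) (λ ()))
             (sum-pair (f ∘ suc) (i≢j ∘ cong suc)
                       (λ k k≢i k≢j → f≡0 (suc k) (k≢i ∘ FinP.suc-injective) (k≢j ∘ FinP.suc-injective))))
  (ℤP.+-identityˡ _)

lookup-⊕ : ∀ {n} (u v : Vec ℤ n) i → lookup (u ⊕ v) i ≡ lookup u i + lookup v i
lookup-⊕ u v i = lookup-zipWith _+_ i u v

lookup-⊖ : ∀ {n} (u v : Vec ℤ n) i → lookup (u ⊖ v) i ≡ lookup u i - lookup v i
lookup-⊖ u v i = lookup-zipWith _-_ i u v

lookup-neg : ∀ {n} (u : Vec ℤ n) i → lookup (neg u) i ≡ - lookup u i
lookup-neg u i = lookup-map i -_ u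

lookup-zeros : ∀ {n} (i : Fin n) → lookup zeros i ≡ 0ℤ
lookup-zeros i = lookup-replicate i 0ℤ

neg-involutive : ∀ {n} (u : Vec ℤ n) → neg (neg u) ≡ u
neg-involutive u = lookup-ext λ i →
  trans (lookup-neg (neg u) i) (trans (cong -_ (lookup-neg u i)) (ℤP.neg-involutive (lookup u i)))

neg-zeros : ∀ {n} → neg (zeros {n}) ≡ zeros
neg-zeros = lookup-ext λ i → trans (lookup-neg zeros i) (trans (cong -_ (lookup-zeros i)) (sym (lookup-zeros i)))

module _ {m n} (M : Mat m n) where

  lookup-·ᵥ : ∀ u l → lookup (M ·ᵥ u) l ≡ sum (λ j → entry M l j * lookup u j)
  lookup-·ᵥ u l = trans (lookup∘tabulate _ l) (∑≡sum (λ j → entry M l j * lookup u j))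

  lookup-ᵥ· : ∀ v j → lookup (v ᵥ· M) j ≡ sum (λ l → lookup v l * entry M l j)
  lookup-ᵥ· v j = trans (lookup∘tabulate _ j) (∑≡sum (λ l → lookup v l * entry M l j))

  ·ᵥ-neg : ∀ u → M ·ᵥ neg u ≡ neg (M ·ᵥ u)
  ·ᵥ-neg u = lookup-ext λ l → begin
    lookup (M ·ᵥ neg u) l                       ≡⟨ lookup-·ᵥ (neg u) l ⟩
    sum (λ j → entry M l j * lookup (neg u) j) ≡⟨ sum-cong-≗ (λ j → cong (entry M l j *_) (lookup-neg u j)) ⟩
    sum (λ j → entry M l j * - lookup u j)     ≡⟨ sum-cong-≗ (λ j → ℤP.neg-distribʳ-* (entry M l j) (lookup u j)) ⟨
    sum (λ j → - (entry M l j * lookup u j))   ≡⟨ sum-neg (λ j → entry M l j * lookup u j) ⟩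
    - sum (λ j → entry M l j * lookup u j)     ≡⟨ cong -_ (lookup-·ᵥ u l) ⟨
    - lookup (M ·ᵥ u) l                         ≡⟨ lookup-neg (M ·ᵥ u) l ⟨
    lookup (neg (M ·ᵥ u)) l                     ∎

  InKer-neg : ∀ u → InKer M u → InKer M (neg u)
  InKer-neg u Mu≡0 = trans (·ᵥ-neg u) (trans (cong neg Mu≡0) neg-zeros)

  ᵥ·-·ᵥ-assoc : ∀ v z → sum (λ t → lookup (v ᵥ· M) t * lookup z t) ≡ sum (λ l → lookup v l * lookup (M ·ᵥ z) l)
  ᵥ·-·ᵥ-assoc v z = begin
    sum (λ t → lookup (v ᵥ· M) t * lookup z t)
      ≡⟨ sum-cong-≗ (λ t → trans (cong (_* lookup z t) (lookup-ᵥ· v t))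
                                 (*-distribʳ-sum (lookup z t) (λ l → lookup v l * entry M l t))) ⟩
    sum (λ t → sum (λ l → lookup v l * entry M l t * lookup z t))
      ≡⟨ ∑-comm (λ t l → lookup v l * entry M l t * lookup z t) ⟩
    sum (λ l → sum (λ t → lookup v l * entry M l t * lookup z t))
      ≡⟨ sum-cong-≗ (λ l → sum-cong-≗ (λ t → ℤP.*-assoc (lookup v l) (entry M l t) (lookup z t))) ⟩
    sum (λ l → sum (λ t → lookup v l * (entry M l t * lookup z t)))
      ≡⟨ sum-cong-≗ (λ l → trans (sym (*-distribˡ-sum (lookup v l) (λ t → entry M l t * lookup z t)))
                                 (cong (lookup v l *_) (sym (lookup-·ᵥ z l)))) ⟩
    sum (λ l → lookup v l * lookup (M ·ᵥ z) l) ∎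

  ᵥ·-orthogonal-ker : ∀ v z → InKer M z → sum (λ t → lookup (v ᵥ· M) t * lookup z t) ≡ 0ℤ
  ᵥ·-orthogonal-ker v z Mz≡0 = begin
    sum (λ t → lookup (v ᵥ· M) t * lookup z t)  ≡⟨ ᵥ·-·ᵥ-assoc v z ⟩
    sum (λ l → lookup v l * lookup (M ·ᵥ z) l) ≡⟨ sum-cong-≗ (λ l → cong (λ w → lookup v l * lookup w l) Mz≡0) ⟩
    sum (λ l → lookup v l * lookup zeros l)
      ≡⟨ sum-cong-≗ (λ l → trans (cong (lookup v l *_) (lookup-zeros l)) (ℤP.*-zeroʳ (lookup v l))) ⟩
    sum {m} (λ _ → 0ℤ)                         ≡⟨ sum-replicate-zero m ⟩
    0ℤ                                         ∎

module _ {n q} (c : Fin q → Vec ℤ n) where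

  lookup-Dmap : ∀ x i → lookup (Dmap c x) i ≡ sum (λ k → lookup x k * lookup (c k) i)
  lookup-Dmap x i = trans (lookup∘tabulate _ i) (∑≡sum (λ k → lookup x k * lookup (c k) i))

  Dmap-⊕ : ∀ x y → Dmap c (x ⊕ y) ≡ Dmap c x ⊕ Dmap c y
  Dmap-⊕ x y = lookup-ext λ i → begin
    lookup (Dmap c (x ⊕ y)) i
      ≡⟨ lookup-Dmap (x ⊕ y) i ⟩
    sum (λ k → lookup (x ⊕ y) k * lookup (c k) i)
      ≡⟨ sum-cong-≗ (λ k → trans (cong (_* lookup (c k) i) (lookup-⊕ x y k))
                                 (ℤP.*-distribʳ-+ (lookup (c k) i) (lookup x k) (lookup y k))) ⟩
    sum (λ k → lookup x k * lookup (c k) i + lookup y k * lookup (c k) i)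
      ≡⟨ ∑-distrib-+ (λ k → lookup x k * lookup (c k) i) (λ k → lookup y k * lookup (c k) i) ⟩
    sum (λ k → lookup x k * lookup (c k) i) + sum (λ k → lookup y k * lookup (c k) i)
      ≡⟨ cong₂ _+_ (lookup-Dmap x i) (lookup-Dmap y i) ⟨
    lookup (Dmap c x) i + lookup (Dmap c y) i
      ≡⟨ lookup-⊕ (Dmap c x) (Dmap c y) i ⟨
    lookup (Dmap c x ⊕ Dmap c y) i ∎

  Dmap-zeros : Dmap c zeros ≡ zeros
  Dmap-zeros = lookup-ext λ i → begin
    lookup (Dmap c zeros) i                        ≡⟨ lookup-Dmap zeros i ⟩
    sum (λ k → lookup zeros k * lookup (c k) i)   ≡⟨ sum-cong-≗ (λ k → cong (_* lookup (c k) i) (lookup-zeros k)) ⟩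
    sum {q} (λ _ → 0ℤ)                            ≡⟨ sum-replicate-zero q ⟩
    0ℤ                                            ≡⟨ lookup-zeros i ⟨
    lookup zeros i                                ∎

  Dmap-neg : ∀ x → Dmap c (neg x) ≡ neg (Dmap c x)
  Dmap-neg x = lookup-ext λ i → begin
    lookup (Dmap c (neg x)) i                      ≡⟨ lookup-Dmap (neg x) i ⟩
    sum (λ k → lookup (neg x) k * lookup (c k) i)
      ≡⟨ sum-cong-≗ (λ k → trans (cong (_* lookup (c k) i) (lookup-neg x k))
                                 (sym (ℤP.neg-distribˡ-* (lookup x k) (lookup (c k) i)))) ⟩
    sum (λ k → - (lookup x k * lookup (c k) i))   ≡⟨ sum-neg (λ k → lookup x k * lookup (c k) i) ⟩
    - sum (λ k → lookup x k * lookup (c k) i)     ≡⟨ cong -_ (lookup-Dmap x i) ⟨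
    - lookup (Dmap c x) i                          ≡⟨ lookup-neg (Dmap c x) i ⟨
    lookup (neg (Dmap c x)) i                      ∎

  Dmap-sumV : ∀ xs → Dmap c (sumV xs) ≡ sumV (List.map (Dmap c) xs)
  Dmap-sumV List.[]       = Dmap-zeros
  Dmap-sumV (x List.∷ xs) = trans (Dmap-⊕ x (sumV xs)) (cong (Dmap c x ⊕_) (Dmap-sumV xs))

  ·ᵥ-Dmap : ∀ {m} (A : Mat m n) x → A ·ᵥ Dmap c x ≡ bouquetMatrix A c ·ᵥ x
  ·ᵥ-Dmap A x = lookup-ext λ l → begin
    lookup (A ·ᵥ Dmap c x) l
      ≡⟨ lookup-·ᵥ A (Dmap c x) l ⟩
    sum (λ i → entry A l i * lookup (Dmap c x) i)
      ≡⟨ sum-cong-≗ (λ i → trans (cong (entry A l i *_) (lookup-Dmap x i))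
                                 (*-distribˡ-sum (entry A l i) (λ k → lookup x k * lookup (c k) i))) ⟩
    sum (λ i → sum (λ k → entry A l i * (lookup x k * lookup (c k) i)))
      ≡⟨ ∑-comm (λ i k → entry A l i * (lookup x k * lookup (c k) i)) ⟩
    sum (λ k → sum (λ i → entry A l i * (lookup x k * lookup (c k) i)))
      ≡⟨ sum-cong-≗ (λ k → sum-cong-≗ (λ i → rearrange (entry A l i) (lookup x k) (lookup (c k) i))) ⟩
    sum (λ k → sum (λ i → lookup (c k) i * entry A l i * lookup x k))
      ≡⟨ sum-cong-≗ (λ k → trans (sym (*-distribʳ-sum (lookup x k) (λ i → lookup (c k) i * entry A l i)))
                                 (cong (_* lookup x k) (sym (entry-bouquetMatrix l k)))) ⟩
    sum (λ k → entry (bouquetMatrix A c) l k * lookup x k)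
      ≡⟨ lookup-·ᵥ (bouquetMatrix A c) x l ⟨
    lookup (bouquetMatrix A c ·ᵥ x) l ∎
    where
    rearrange : ∀ a b d → a * (b * d) ≡ d * a * b
    rearrange = solve-∀
    entry-bouquetMatrix : ∀ l k → entry (bouquetMatrix A c) l k ≡ sum (λ i → lookup (c k) i * entry A l i)
    entry-bouquetMatrix l k =
      trans (cong (λ row → lookup row k) (lookup∘tabulate _ l))
            (trans (lookup∘tabulate _ k) (∑≡sum (λ i → lookup (c k) i * entry A l i)))

-- Markov bases

module _ {m N} (M : Mat m N) where

  open DecMembership (≡-dec {n = N} ℤ._≟_) using (_∈?_)
  open DecSubset (≡-dec {n = N} ℤ._≟_) using (_⊆?_)

  IsMarkovBasis-⊆ : ∀ {L L′} → L ⊆ L′ → (∀ v → v ∈ L′ → InKer M v) → IsMarkovBasis M L → IsMarkovBasis M L′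
  IsMarkovBasis-⊆ L⊆L′ L′⊆Ker (_ , connected) = L′⊆Ker , λ w u w≥0 u≥0 w-u∈Ker →
    let vs , vs∈±L , vs-stay , w-u≡∑vs = connected w u w≥0 u≥0 w-u∈Ker in
    vs , All.map [ inj₁ ∘ L⊆L′ , inj₂ ∘ L⊆L′ ] vs∈±L , vs-stay , w-u≡∑vs

  -- Minimality is not decidable, so a minimal sub-basis can only be found up to double negation.
  minimal-⊆-MarkovBasis : ∀ {L} → IsMarkovBasis M L → ¬ ¬ (∃[ L₀ ] (L₀ ⊆ L × IsMinimalMarkovBasis M L₀))
  minimal-⊆-MarkovBasis {L} = go L (On.wellFounded length <-wellFounded L)
    where
    go : ∀ L → Acc (ℕ._<_ on length) L → IsMarkovBasis M L → ¬ ¬ (∃[ L₀ ] (L₀ ⊆ L × IsMinimalMarkovBasis M L₀))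
    go L (acc smaller) basis noMinimal = noMinimal (L , id , basis , minimal)
      where
      minimal : ∀ L′ → L′ ⊆ L → IsMarkovBasis M L′ → L ⊆ L′
      minimal L′ L′⊆L basis′ with L ⊆? L′
      ... | yes L⊆L′ = L⊆L′
      ... | no L⊈L′ = ⊥-elim (go L″ (smaller shorter) basis″ λ (L₀ , L₀⊆L″ , min) →
                                   noMinimal (L₀ , filter-⊆ (_∈? L′) L ∘ L₀⊆L″ , min))
        where
        L″ = filter (_∈? L′) L
        shorter : length L″ ℕ.< length L
        shorter = filter-notAll (_∈? L′) L (¬All⇒Any¬ (_∈? L′) L (L⊈L′ ∘ All.lookup))
        basis″ : IsMarkovBasis M L″
        basis″ = IsMarkovBasis-⊆ (λ v∈L′ → ∈-filter⁺ (_∈? L′) (L′⊆L v∈L′) v∈L′)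
                   (λ v v∈L″ → proj₁ basis v (filter-⊆ (_∈? L′) L v∈L″)) basis′

-- Adjacency and kernel coordinates

KerProportional : ∀ {m n} → Mat m n → Fin n → Fin n → Set
KerProportional A i l =
  ∃₂ λ α α′ → α ≢ 0ℤ × α′ ≢ 0ℤ × (∀ z → InKer A z → α * lookup z i ≡ α′ * lookup z l)

module _ {m n} (A : Mat m n) where

  KerProportional-isEquivalence : IsEquivalence (KerProportional A)
  KerProportional-isEquivalence = record
    { refl  = 1ℤ , 1ℤ , (λ ()) , (λ ()) , λ _ _ → refl
    ; sym   = λ (α , α′ , α≢0 , α′≢0 , eq) → α′ , α , α′≢0 , α≢0 , λ z z∈Ker → sym (eq z z∈Ker)
    ; trans = λ (α , α′ , α≢0 , α′≢0 , eq) (γ , γ′ , γ≢0 , γ′≢0 , eq′) →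
        γ * α , α′ * γ′ , *-≢0 γ≢0 α≢0 , *-≢0 α′≢0 γ′≢0 ,
        λ z z∈Ker → compose γ α′ γ′ (eq z z∈Ker) (eq′ z z∈Ker)
    }
    where
    compose : ∀ {α a b d} γ α′ γ′ → α * a ≡ α′ * b → γ * b ≡ γ′ * d → γ * α * a ≡ α′ * γ′ * d
    compose {α} {a} {b} {d} γ α′ γ′ αa≡α′b γb≡γ′d = begin
      γ * α * a     ≡⟨ ℤP.*-assoc γ α a ⟩
      γ * (α * a)   ≡⟨ cong (γ *_) αa≡α′b ⟩
      γ * (α′ * b)  ≡⟨ swap γ α′ b ⟩
      α′ * (γ * b)  ≡⟨ cong (α′ *_) γb≡γ′d ⟩
      α′ * (γ′ * d) ≡⟨ ℤP.*-assoc α′ γ′ d ⟨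
      α′ * γ′ * d   ∎
      where
      swap : ∀ x y z → x * (y * z) ≡ y * (x * z)
      swap = solve-∀

  -- If the row vector v A is supported on {i, l}, then 0 = (v A) z = (v A)ᵢ zᵢ + (v A)ₗ zₗ.
  Adjacent⇒KerProportional : ∀ {i l} → Adjacent A i l → KerProportional A i l
  Adjacent⇒KerProportional {i} {l} (i≢l , v , vAᵢ≢0 , vAₗ≢0 , vA-support) =
    a i , - a l , vAᵢ≢0 , -‿≢0 vAₗ≢0 , λ z z∈Ker → proportional z z∈Ker
    where
    a : Fin n → ℤ
    a = lookup (v ᵥ· A)
    proportional : ∀ z → InKer A z → a i * lookup z i ≡ - a l * lookup z l
    proportional z z∈Ker = begin
      a i * lookup z i                               ≡⟨ shift (a i * lookup z i) (a l * lookup z l) ⟩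
      (a i * lookup z i + a l * lookup z l) - a l * lookup z l
        ≡⟨ cong (_- a l * lookup z l) (trans (sym pair) (ᵥ·-orthogonal-ker A v z z∈Ker)) ⟩
      0ℤ - a l * lookup z l                          ≡⟨ ℤP.+-identityˡ (- (a l * lookup z l)) ⟩
      - (a l * lookup z l)                           ≡⟨ ℤP.neg-distribˡ-* (a l) (lookup z l) ⟩
      - a l * lookup z l                             ∎
      where
      pair = sum-pair (λ t → a t * lookup z t) i≢l (λ t t≢i t≢l → cong (_* lookup z t) (vA-support t t≢i t≢l))
      shift : ∀ x y → x ≡ (x + y) - y
      shift = solve-∀

  sameBouquet⇒KerProportional : ∀ {i l} → EqClosure (Adjacent A) i l → KerProportional A i l
  sameBouquet⇒KerProportional = fold KerProportional-isEquivalence Adjacent⇒KerProportional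

restrict : ∀ {n q} → (Fin n → Fin q) → Fin q → (Fin n → ℕ) → Fin n → ℕ
restrict β k f i = if ⌊ β i Fin.≟ k ⌋ then f i else 0

module _ {n q} (β : Fin n → Fin q) (k : Fin q) where

  restrict-cong : ∀ {f f′} → (∀ {i} → β i ≡ k → f i ≡ f′ i) → ∀ i → restrict β k f i ≡ restrict β k f′ i
  restrict-cong f≡f′ i with β i Fin.≟ k
  ... | yes βi≡k  = f≡f′ βi≡k
  ... | no _      = refl

  restrict-*ˡ : ∀ d f i → restrict β k (λ l → d ℕ.* f l) i ≡ d ℕ.* restrict β k f i
  restrict-*ˡ d f i with β i Fin.≟ k
  ... | yes _     = refl
  ... | no _      = sym (ℕP.*-zeroʳ d)

gcdOver-cong : ∀ {n} {f g : Fin n → ℕ} → (∀ i → f i ≡ g i) → gcdOver f ≡ gcdOver g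
gcdOver-cong {ℕ.zero}  _   = refl
gcdOver-cong {ℕ.suc n} f≡g = cong₂ gcd (f≡g zero) (gcdOver-cong (f≡g ∘ suc))

gcdOver-*ˡ : ∀ {n} d (f : Fin n → ℕ) → gcdOver (λ i → d ℕ.* f i) ≡ d ℕ.* gcdOver f
gcdOver-*ˡ {ℕ.zero}  d f = sym (ℕP.*-zeroʳ d)
gcdOver-*ˡ {ℕ.suc n} d f = trans (cong (gcd (d ℕ.* f zero)) (gcdOver-*ˡ d (f ∘ suc)))
                                 (sym (c*gcd[m,n]≡gcd[cm,cn] d (f zero) (gcdOver (f ∘ suc))))

gcdOver-greatest : ∀ {n d} {f : Fin n → ℕ} → (∀ i → d ℕD.∣ f i) → d ℕD.∣ gcdOver f
gcdOver-greatest {ℕ.zero}  {d} _   = d ℕD.∣0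
gcdOver-greatest {ℕ.suc n}     d∣f = gcd-greatest (d∣f zero) (gcdOver-greatest (d∣f ∘ suc))

-- |b i₀| divides |a i₀| |b l| for every l in the bouquet, hence divides |a i₀| gcd(|b|) = |a i₀|.
proportional⇒multiple : ∀ {n q} (β : Fin n → Fin q) k (a b : Fin n → ℤ) {i₀} → β i₀ ≡ k → b i₀ ≢ 0ℤ →
  gcdOver (restrict β k (∣_∣ ∘ b)) ≡ 1 →
  (∀ i l → β i ≡ k → β l ≡ k → a i * b l ≡ a l * b i) →
  ∃[ x ] (∀ i → β i ≡ k → a i ≡ x * b i)
proportional⇒multiple β k a b {i₀} βi₀ bi₀≢0 b-primitive minors = quotient , λ i βi → *-cancelʳ-≢0 bi₀≢0 (begin
  a i * b i₀            ≡⟨ minors i i₀ βi βi₀ ⟩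
  a i₀ * b i            ≡⟨ cong (_* b i) equality ⟩
  quotient * b i₀ * b i ≡⟨ swap quotient (b i₀) (b i) ⟩
  quotient * b i * b i₀ ∎)
  where
  swap : ∀ x y z → x * y * z ≡ x * z * y
  swap = solve-∀
  divides-each : ∀ l → ∣ b i₀ ∣ ℕD.∣ ∣ a i₀ ∣ ℕ.* restrict β k (∣_∣ ∘ b) l
  divides-each l with β l Fin.≟ k
  ... | yes βl = ℕD.divides ∣ a l ∣ (begin
    ∣ a i₀ ∣ ℕ.* ∣ b l ∣  ≡⟨ ℤP.abs-* (a i₀) (b l) ⟨
    ∣ a i₀ * b l ∣        ≡⟨ cong ∣_∣ (minors i₀ l βi₀ βl) ⟩
    ∣ a l * b i₀ ∣        ≡⟨ ℤP.abs-* (a l) (b i₀) ⟩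
    ∣ a l ∣ ℕ.* ∣ b i₀ ∣  ∎)
  ... | no _ = subst (∣ b i₀ ∣ ℕD.∣_) (sym (ℕP.*-zeroʳ ∣ a i₀ ∣)) (∣ b i₀ ∣ ℕD.∣0)
  bi₀∣ai₀ : ∣ b i₀ ∣ ℕD.∣ ∣ a i₀ ∣
  bi₀∣ai₀ = subst (∣ b i₀ ∣ ℕD.∣_) (begin
    gcdOver (λ l → ∣ a i₀ ∣ ℕ.* restrict β k (∣_∣ ∘ b) l) ≡⟨ gcdOver-*ˡ ∣ a i₀ ∣ (restrict β k (∣_∣ ∘ b)) ⟩
    ∣ a i₀ ∣ ℕ.* gcdOver (restrict β k (∣_∣ ∘ b))        ≡⟨ cong (∣ a i₀ ∣ ℕ.*_) b-primitive ⟩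
    ∣ a i₀ ∣ ℕ.* 1                                       ≡⟨ ℕP.*-identityʳ ∣ a i₀ ∣ ⟩
    ∣ a i₀ ∣                                             ∎) (gcdOver-greatest divides-each)
  open ℤD._∣_ (ℤD.∣ᵤ⇒∣ {b i₀} {a i₀} bi₀∣ai₀) using (quotient; equality)

-- Bouquets

module Bouquets {m n q r} (A : Mat m n) (Gm : Mat n r) (kerBasis : IsKerBasis A Gm)
  (β : Fin n → Fin q) (labelling : IsBouquetLabelling A β)
  (c : Fin q → Vec ℤ n) (bouquetVector : ∀ k → IsBouquetVector Gm β k (c k)) where

  first-of : ∀ k → ∃ (IsFirstOf β k)
  first-of k = least-witness (λ i → β i Fin.≟ k) (proj₁ labelling k)

  c-support : ∀ k {i} → β i ≢ k → lookup (c k) i ≡ 0ℤ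
  c-support k {i} βi≢k with bouquetVector k
  ... | inj₁ (_ , _ , support , _) = decidable-stable (lookup (c k) i ℤ.≟ 0ℤ) (βi≢k ∘ proj₁ (support i))
  ... | inj₂ (_ , _ , _ , scaled)  = proj₂ (scaled _ (proj₂ (first-of k)) i) βi≢k

  γ : Fin n → ℤ
  γ i = lookup (c (β i)) i

  lookup-Dmap-γ : ∀ x i → lookup (Dmap c x) i ≡ lookup x (β i) * γ i
  lookup-Dmap-γ x i = trans (lookup-Dmap c x i) (sum-single (λ k → lookup x k * lookup (c k) i) (β i)
    (λ k k≢βi → trans (cong (lookup x k *_) (c-support k (k≢βi ∘ sym))) (ℤP.*-zeroʳ (lookup x k))))

  module NonFree (k : Fin q) (j : Fin r)
    (nonzero : ∀ i → β i ≡ k → entry Gm i j ≢ 0ℤ)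
    (scaled : ∀ i₀ → IsFirstOf β k i₀ → ∀ i →
                (β i ≡ k → lookup (c k) i * + bouquetGcd Gm β k j ≡ sgn (entry Gm i₀ j) * entry Gm i j) ×
                (¬ β i ≡ k → lookup (c k) i ≡ 0ℤ)) where

    i₀ : Fin n
    i₀ = proj₁ (first-of k)

    βi₀ : β i₀ ≡ k
    βi₀ = proj₁ (proj₂ (first-of k))

    h : Fin n → ℤ
    h i = entry Gm i j

    g : ℕ
    g = bouquetGcd Gm β k j

    c*g≡sgn*h : ∀ {i} → β i ≡ k → lookup (c k) i * + g ≡ sgn (h i₀) * h i
    c*g≡sgn*h {i} = proj₁ (scaled i₀ (proj₂ (first-of k)) i)

    sgn≢0 : sgn (h i₀) ≢ 0ℤ
    sgn≢0 = sgn-≢0 (nonzero i₀ βi₀)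

    c*g≢0 : ∀ {i} → β i ≡ k → lookup (c k) i * + g ≢ 0ℤ
    c*g≢0 βi c*g≡0 = *-≢0 sgn≢0 (nonzero _ βi) (trans (sym (c*g≡sgn*h βi)) c*g≡0)

    c≢0 : ∀ {i} → β i ≡ k → lookup (c k) i ≢ 0ℤ
    c≢0 βi c≡0 = c*g≢0 βi (cong (_* + g) c≡0)

    g≢0 : g ≢ 0
    g≢0 g≡0 = c*g≢0 βi₀ (trans (cong (λ t → lookup (c k) i₀ * + t) g≡0) (ℤP.*-zeroʳ (lookup (c k) i₀)))

    c-positive : 0ℤ ℤ.< lookup (c k) i₀
    c-positive = ℤP.*-cancelʳ-<-nonNeg (+ g)
      (subst (0ℤ ℤ.<_) (sym (trans (c*g≡sgn*h βi₀) (sgn*i≡+∣i∣ (h i₀)))) (i≢0⇒0<+∣i∣ (nonzero i₀ βi₀)))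

    ∣h∣≡g*∣c∣ : ∀ {i} → β i ≡ k → ∣ h i ∣ ≡ g ℕ.* ∣ lookup (c k) i ∣
    ∣h∣≡g*∣c∣ {i} βi = begin
      ∣ h i ∣                    ≡⟨ ∣sgn[j]*i∣≡∣i∣ (nonzero i₀ βi₀) (h i) ⟨
      ∣ sgn (h i₀) * h i ∣       ≡⟨ cong ∣_∣ (c*g≡sgn*h βi) ⟨
      ∣ lookup (c k) i * + g ∣   ≡⟨ ℤP.abs-* (lookup (c k) i) (+ g) ⟩
      ∣ lookup (c k) i ∣ ℕ.* g   ≡⟨ ℕP.*-comm ∣ lookup (c k) i ∣ g ⟩
      g ℕ.* ∣ lookup (c k) i ∣   ∎

    -- g is by definition the gcd of the |h i| over the bouquet, and |h i| = g |cₖ i| there.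
    c-primitive : gcdOver (restrict β k (∣_∣ ∘ lookup (c k))) ≡ 1
    c-primitive = sym (ℕP.*-cancelˡ-≡ 1 _ g {{ℕ.≢-nonZero g≢0}} (begin
      g ℕ.* 1                                               ≡⟨ ℕP.*-identityʳ g ⟩
      gcdOver (restrict β k (∣_∣ ∘ h))                      ≡⟨ gcdOver-cong (restrict-cong β k ∣h∣≡g*∣c∣) ⟩
      gcdOver (restrict β k (λ i → g ℕ.* ∣ lookup (c k) i ∣)) ≡⟨ gcdOver-cong (restrict-*ˡ β k g (∣_∣ ∘ lookup (c k))) ⟩
      gcdOver (λ i → g ℕ.* restrict β k (∣_∣ ∘ lookup (c k)) i) ≡⟨ gcdOver-*ˡ g (restrict β k (∣_∣ ∘ lookup (c k))) ⟩
      g ℕ.* gcdOver (restrict β k (∣_∣ ∘ lookup (c k)))     ∎))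

    -- The column h of Gm lies in Ker A, so it satisfies the same proportionality as w.
    ker-minors-h : ∀ w → InKer A w → ∀ {i l} → β i ≡ k → β l ≡ k → lookup w i * h l ≡ lookup w l * h i
    ker-minors-h w w∈Ker {i} {l} βi βl with sameBouquet⇒KerProportional A (proj₁ (proj₂ labelling i l) (trans βi (sym βl)))
    ... | α , α′ , α≢0 , _ , proportional =
      cross-multiply α α′ (lookup w i) (lookup w l) (h i) (h l) α≢0 (proportional w w∈Ker) h-proportional
      where
      h-proportional : α * h i ≡ α′ * h l
      h-proportional = subst₂ (λ x y → α * x ≡ α′ * y)
        (lookup∘tabulate (λ t → entry Gm t j) i) (lookup∘tabulate (λ t → entry Gm t j) l)
        (proportional (column Gm j) (proj₁ kerBasis j))

    ker-minors : ∀ w → InKer A w → ∀ i l → β i ≡ k → β l ≡ k →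
                 lookup w i * lookup (c k) l ≡ lookup w l * lookup (c k) i
    ker-minors w w∈Ker i l βi βl = ℤP.*-cancelʳ-≡ _ _ (+ g) {{ℕ.≢-nonZero g≢0}} (begin
      lookup w i * lookup (c k) l * + g   ≡⟨ ℤP.*-assoc (lookup w i) (lookup (c k) l) (+ g) ⟩
      lookup w i * (lookup (c k) l * + g) ≡⟨ cong (lookup w i *_) (c*g≡sgn*h βl) ⟩
      lookup w i * (sgn (h i₀) * h l)     ≡⟨ swap (lookup w i) (sgn (h i₀)) (h l) ⟩
      sgn (h i₀) * (lookup w i * h l)     ≡⟨ cong (sgn (h i₀) *_) (ker-minors-h w w∈Ker βi βl) ⟩
      sgn (h i₀) * (lookup w l * h i)     ≡⟨ swap (lookup w l) (sgn (h i₀)) (h i) ⟨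
      lookup w l * (sgn (h i₀) * h i)     ≡⟨ cong (lookup w l *_) (c*g≡sgn*h βi) ⟨
      lookup w l * (lookup (c k) i * + g) ≡⟨ ℤP.*-assoc (lookup w l) (lookup (c k) i) (+ g) ⟨
      lookup w l * lookup (c k) i * + g   ∎)
      where
      swap : ∀ x y z → x * (y * z) ≡ y * (x * z)
      swap = solve-∀

    ker-multiple : ∀ w → InKer A w → ∃[ x ] (∀ i → β i ≡ k → lookup w i ≡ x * lookup (c k) i)
    ker-multiple w w∈Ker =
      proportional⇒multiple β k (lookup w) (lookup (c k)) βi₀ (c≢0 βi₀) c-primitive (ker-minors w w∈Ker)

  γ≢0 : ∀ i → γ i ≢ 0ℤ
  γ≢0 i with bouquetVector (β i)
  ... | inj₁ (_ , _ , support , _)        = proj₂ (support i) refl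
  ... | inj₂ (_ , j , nonzero , scaled)   = NonFree.c≢0 (β i) j nonzero scaled refl

  positive-in-bouquet : ∀ k → ∃[ i ] (β i ≡ k × 0ℤ ℤ.< lookup (c k) i)
  positive-in-bouquet k with bouquetVector k
  ... | inj₂ (_ , j , nonzero , scaled) = i₀ , βi₀ , c-positive
    where open NonFree k j nonzero scaled
  ... | inj₁ (_ , c≢0 , support , first-positive)
    with least-witness (λ i → ¬? (lookup (c k) i ℤ.≟ 0ℤ)) c≢0
  ...   | i , cᵢ≢0 , i-least = i , proj₁ (support i) cᵢ≢0 , first-positive i cᵢ≢0 λ i′ i′<i →
            decidable-stable (lookup (c k) i′ ℤ.≟ 0ℤ) (λ cᵢ′≢0 → ℕP.<⇒≱ i′<i (i-least i′ cᵢ′≢0))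

  Dmap-injective : ∀ {x y} → Dmap c x ≡ Dmap c y → x ≡ y
  Dmap-injective {x} {y} Dx≡Dy = lookup-ext λ k →
    let i , βi≡k = proj₁ labelling k in
    subst (λ k → lookup x k ≡ lookup y k) βi≡k (*-cancelʳ-≢0 (γ≢0 i) (begin
      lookup x (β i) * γ i   ≡⟨ lookup-Dmap-γ x i ⟨
      lookup (Dmap c x) i    ≡⟨ cong (λ v → lookup v i) Dx≡Dy ⟩
      lookup (Dmap c y) i    ≡⟨ lookup-Dmap-γ y i ⟩
      lookup y (β i) * γ i   ∎))

  ker-free-coordinate : ∀ w {i} → InKer A w → lookup Gm i ≡ zeros → lookup w i ≡ 0ℤ
  ker-free-coordinate w {i} w∈Ker Gᵢ≡0 = begin
    lookup w i                              ≡⟨ cong (λ v → lookup v i) Gλ≡w ⟨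
    lookup (Gm ·ᵥ λs) i                     ≡⟨ lookup-·ᵥ Gm λs i ⟩
    sum (λ t → entry Gm i t * lookup λs t)  ≡⟨ sum-cong-≗ (λ t → cong (λ row → lookup row t * lookup λs t) Gᵢ≡0) ⟩
    sum (λ t → lookup zeros t * lookup λs t) ≡⟨ sum-cong-≗ (λ t → cong (_* lookup λs t) (lookup-zeros t)) ⟩
    sum {r} (λ _ → 0ℤ)                      ≡⟨ sum-replicate-zero r ⟩
    0ℤ                                      ∎
    where
    λs : Vec ℤ r
    λs = proj₁ (proj₂ (proj₂ kerBasis) w w∈Ker)
    Gλ≡w : Gm ·ᵥ λs ≡ w
    Gλ≡w = proj₂ (proj₂ (proj₂ kerBasis) w w∈Ker)

  ker-multiple : ∀ w → InKer A w → ∀ k → ∃[ x ] (∀ i → β i ≡ k → lookup w i ≡ x * lookup (c k) i)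
  ker-multiple w w∈Ker k with bouquetVector k
  ... | inj₁ (free , _)                   = 0ℤ , λ i βi → ker-free-coordinate w w∈Ker (free i βi)
  ... | inj₂ (_ , j , nonzero , scaled)   = NonFree.ker-multiple k j nonzero scaled w w∈Ker

  Dmap-surjective : ∀ w → InKer A w → ∃[ x ] (Dmap c x ≡ w)
  Dmap-surjective w w∈Ker = x , lookup-ext λ i → begin
    lookup (Dmap c x) i                      ≡⟨ lookup-Dmap-γ x i ⟩
    lookup x (β i) * γ i                     ≡⟨ cong (_* γ i) (lookup∘tabulate _ (β i)) ⟩
    proj₁ (ker-multiple w w∈Ker (β i)) * γ i  ≡⟨ proj₂ (ker-multiple w w∈Ker (β i)) i refl ⟨
    lookup w i                               ∎
    where
    x : Vec ℤ q
    x = tabulate λ k → proj₁ (ker-multiple w w∈Ker k)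

  -- A preimage under D on Ker A; zeros outside it.
  pre : Vec ℤ n → Vec ℤ q
  pre v with ≡-dec ℤ._≟_ (A ·ᵥ v) zeros
  ... | yes v∈Ker = proj₁ (Dmap-surjective v v∈Ker)
  ... | no _      = zeros

  Dmap-pre : ∀ {v} → InKer A v → Dmap c (pre v) ≡ v
  Dmap-pre {v} v∈Ker with ≡-dec ℤ._≟_ (A ·ᵥ v) zeros
  ... | yes v∈Ker′ = proj₂ (Dmap-surjective v v∈Ker′)
  ... | no v∉Ker   = ⊥-elim (v∉Ker v∈Ker)

  InKer-pre : ∀ {v} → InKer A v → InKer (bouquetMatrix A c) (pre v)
  InKer-pre {v} v∈Ker = trans (sym (·ᵥ-Dmap c A (pre v))) (trans (cong (A ·ᵥ_) (Dmap-pre v∈Ker)) v∈Ker)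

  pre-neg : ∀ {v} → InKer A v → pre (neg v) ≡ neg (pre v)
  pre-neg {v} v∈Ker = Dmap-injective (begin
    Dmap c (pre (neg v))  ≡⟨ Dmap-pre (InKer-neg A v v∈Ker) ⟩
    neg v                 ≡⟨ cong neg (Dmap-pre v∈Ker) ⟨
    neg (Dmap c (pre v))  ≡⟨ Dmap-neg c (pre v) ⟨
    Dmap c (neg (pre v))  ∎)

  Dmap-sumV-pre : ∀ {vs} → All (InKer A) vs → Dmap c (sumV (List.map pre vs)) ≡ sumV vs
  Dmap-sumV-pre {vs} vs∈Ker = trans (Dmap-sumV c (List.map pre vs)) (cong sumV (map-Dmap-pre vs∈Ker))
    where
    map-Dmap-pre : ∀ {vs} → All (InKer A) vs → List.map (Dmap c) (List.map pre vs) ≡ vs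
    map-Dmap-pre []                 = refl
    map-Dmap-pre (v∈Ker ∷ vs∈Ker)   = cong₂ List._∷_ (Dmap-pre v∈Ker) (map-Dmap-pre vs∈Ker)

  -- Every bouquet has a column with γ > 0, so a lift P of p determines the signs of p.
  IsLiftOf : Vec ℤ n → Vec ℤ q → Set
  IsLiftOf P p = ∀ i → 0ℤ ℤ.< γ i → lookup P i ≡ lookup p (β i) * γ i

  IsLiftOf-⊖ : ∀ {P p v} → IsLiftOf P p → InKer A v → IsLiftOf (P ⊖ v) (p ⊖ pre v)
  IsLiftOf-⊖ {P} {p} {v} P-lifts v∈Ker i 0<γᵢ = begin
    lookup (P ⊖ v) i                                   ≡⟨ lookup-⊖ P v i ⟩
    lookup P i - lookup v i                            ≡⟨ cong₂ _-_ (P-lifts i 0<γᵢ) vᵢ≡ ⟩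
    lookup p (β i) * γ i - lookup (pre v) (β i) * γ i  ≡⟨ distrib (lookup p (β i)) (lookup (pre v) (β i)) (γ i) ⟨
    (lookup p (β i) - lookup (pre v) (β i)) * γ i      ≡⟨ cong (_* γ i) (lookup-⊖ p (pre v) (β i)) ⟨
    lookup (p ⊖ pre v) (β i) * γ i                     ∎
    where
    distrib : ∀ x y z → (x - y) * z ≡ x * z - y * z
    distrib = solve-∀
    vᵢ≡ : lookup v i ≡ lookup (pre v) (β i) * γ i
    vᵢ≡ = trans (cong (λ v → lookup v i) (sym (Dmap-pre v∈Ker))) (lookup-Dmap-γ (pre v) i)

  IsLiftOf-NonNeg : ∀ {P p} → IsLiftOf P p → NonNeg P → NonNeg p
  IsLiftOf-NonNeg {P} {p} P-lifts P≥0 k = subst (λ k → 0ℤ ℤ.≤ lookup p k) βi≡k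
    (0<j⇒0≤i*j⇒0≤i 0<γᵢ (subst (0ℤ ℤ.≤_) (P-lifts i 0<γᵢ) (P≥0 i)))
    where
    i = proj₁ (positive-in-bouquet k)
    βi≡k = proj₁ (proj₂ (positive-in-bouquet k))
    0<γᵢ : 0ℤ ℤ.< γ i
    0<γᵢ = subst (λ k → 0ℤ ℤ.< lookup (c k) i) (sym βi≡k) (proj₂ (proj₂ (positive-in-bouquet k)))

  StaysNonNeg-pre : ∀ {P p vs} → IsLiftOf P p → All (InKer A) vs → StaysNonNeg P vs → StaysNonNeg p (List.map pre vs)
  StaysNonNeg-pre _       []               _              = tt
  StaysNonNeg-pre {P} {p} {v List.∷ _} P-lifts (v∈Ker ∷ vs∈Ker) (P-v≥0 , rest) =
    IsLiftOf-NonNeg {P ⊖ v} {p ⊖ pre v} P-v-lifts P-v≥0 , StaysNonNeg-pre P-v-lifts vs∈Ker rest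
    where
    P-v-lifts : IsLiftOf (P ⊖ v) (p ⊖ pre v)
    P-v-lifts = IsLiftOf-⊖ {P} {p} {v} P-lifts v∈Ker

  -- Columns with negative coefficient take their entry from the other vector,
  -- so that lift w u ⊖ lift u w ≡ Dmap c (w ⊖ u) with both lifts nonnegative.
  lift-entry : Vec ℤ q → Vec ℤ q → Fin n → ℤ
  lift-entry w u i = if does (0ℤ ℤ.<? γ i) then lookup w (β i) * γ i else lookup u (β i) * - γ i

  lift : Vec ℤ q → Vec ℤ q → Vec ℤ n
  lift w u = tabulate (lift-entry w u)

  lift-NonNeg : ∀ w u → NonNeg w → NonNeg u → NonNeg (lift w u)
  lift-NonNeg w u w≥0 u≥0 i rewrite lookup∘tabulate (lift-entry w u) i with 0ℤ ℤ.<? γ i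
  ... | yes 0<γᵢ = 0≤i⇒0≤j⇒0≤i*j (w≥0 (β i)) (ℤP.<⇒≤ 0<γᵢ)
  ... | no 0≮γᵢ  = 0≤i⇒0≤j⇒0≤i*j (u≥0 (β i)) (ℤP.neg-mono-≤ (ℤP.≮⇒≥ 0≮γᵢ))

  lift-IsLiftOf : ∀ w u → IsLiftOf (lift w u) w
  lift-IsLiftOf w u i 0<γᵢ rewrite lookup∘tabulate (lift-entry w u) i with 0ℤ ℤ.<? γ i
  ... | yes _    = refl
  ... | no 0≮γᵢ  = ⊥-elim (0≮γᵢ 0<γᵢ)

  lift-⊖ : ∀ w u → lift w u ⊖ lift u w ≡ Dmap c (w ⊖ u)
  lift-⊖ w u = lookup-ext λ i → begin
    lookup (lift w u ⊖ lift u w) i                 ≡⟨ lookup-⊖ (lift w u) (lift u w) i ⟩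
    lookup (lift w u) i - lookup (lift u w) i
      ≡⟨ cong₂ _-_ (lookup∘tabulate (lift-entry w u) i) (lookup∘tabulate (lift-entry u w) i) ⟩
    lift-entry w u i - lift-entry u w i            ≡⟨ by-sign i ⟩
    (lookup w (β i) - lookup u (β i)) * γ i        ≡⟨ cong (_* γ i) (lookup-⊖ w u (β i)) ⟨
    lookup (w ⊖ u) (β i) * γ i                     ≡⟨ lookup-Dmap-γ (w ⊖ u) i ⟨
    lookup (Dmap c (w ⊖ u)) i                      ∎
    where
    by-sign : ∀ i → lift-entry w u i - lift-entry u w i ≡ (lookup w (β i) - lookup u (β i)) * γ i
    by-sign i with 0ℤ ℤ.<? γ i
    ... | yes _ = positive (lookup w (β i)) (lookup u (β i)) (γ i)
      where
      positive : ∀ x y z → x * z - y * z ≡ (x - y) * z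
      positive = solve-∀
    ... | no _  = negative (lookup w (β i)) (lookup u (β i)) (γ i)
      where
      negative : ∀ x y z → y * - z - x * - z ≡ (x - y) * z
      negative = solve-∀

  pullback-MarkovBasis : ∀ {𝓜} → IsMarkovBasis A 𝓜 → IsMarkovBasis (bouquetMatrix A c) (List.map pre 𝓜)
  pullback-MarkovBasis {𝓜} (𝓜⊆Ker , connected) = pre𝓜⊆Ker , connected′
    where
    ±𝓜⊆Ker : ∀ {v} → v ∈ 𝓜 ⊎ neg v ∈ 𝓜 → InKer A v
    ±𝓜⊆Ker {v} (inj₁ v∈𝓜)  = 𝓜⊆Ker v v∈𝓜
    ±𝓜⊆Ker {v} (inj₂ -v∈𝓜) = subst (InKer A) (neg-involutive v) (InKer-neg A (neg v) (𝓜⊆Ker (neg v) -v∈𝓜))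

    pre𝓜⊆Ker : ∀ x → x ∈ List.map pre 𝓜 → InKer (bouquetMatrix A c) x
    pre𝓜⊆Ker x x∈pre𝓜 with ∈-map⁻ pre x∈pre𝓜
    ... | v , v∈𝓜 , refl = InKer-pre (𝓜⊆Ker v v∈𝓜)

    pre-± : ∀ {v} → v ∈ 𝓜 ⊎ neg v ∈ 𝓜 → pre v ∈ List.map pre 𝓜 ⊎ neg (pre v) ∈ List.map pre 𝓜
    pre-± (inj₁ v∈𝓜)      = inj₁ (∈-map⁺ pre v∈𝓜)
    pre-± v±∈@(inj₂ -v∈𝓜) = inj₂ (subst (_∈ List.map pre 𝓜) (pre-neg (±𝓜⊆Ker v±∈)) (∈-map⁺ pre -v∈𝓜))

    connected′ : ∀ w u → NonNeg w → NonNeg u → InKer (bouquetMatrix A c) (w ⊖ u) →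
      ∃[ xs ] (All (λ x → x ∈ List.map pre 𝓜 ⊎ neg x ∈ List.map pre 𝓜) xs × StaysNonNeg w xs × (w ⊖ u ≡ sumV xs))
    connected′ w u w≥0 u≥0 w-u∈Ker =
      List.map pre vs , map⁺ (All.map pre-± vs∈±𝓜) , StaysNonNeg-pre (lift-IsLiftOf w u) vs∈Ker vs-stay ,
      Dmap-injective (begin
        Dmap c (w ⊖ u)                ≡⟨ lift-⊖ w u ⟨
        lift w u ⊖ lift u w           ≡⟨ W-U≡∑vs ⟩
        sumV vs                       ≡⟨ Dmap-sumV-pre vs∈Ker ⟨
        Dmap c (sumV (List.map pre vs)) ∎)
      where
      W-U∈Ker : InKer A (lift w u ⊖ lift u w)
      W-U∈Ker = trans (cong (A ·ᵥ_) (lift-⊖ w u)) (trans (·ᵥ-Dmap c A (w ⊖ u)) w-u∈Ker)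
      path = connected (lift w u) (lift u w) (lift-NonNeg w u w≥0 u≥0) (lift-NonNeg u w u≥0 w≥0) W-U∈Ker
      vs = proj₁ path
      vs∈±𝓜 = proj₁ (proj₂ path)
      vs-stay = proj₁ (proj₂ (proj₂ path))
      W-U≡∑vs = proj₂ (proj₂ (proj₂ path))
      vs∈Ker = All.map ±𝓜⊆Ker vs∈±𝓜

  Dmap-∈ : ∀ {𝓜 x} → IsMarkovBasis A 𝓜 → x ∈ List.map pre 𝓜 → Dmap c x ∈ 𝓜
  Dmap-∈ {𝓜} (𝓜⊆Ker , _) x∈pre𝓜 with ∈-map⁻ pre x∈pre𝓜
  ... | v , v∈𝓜 , refl = subst (_∈ 𝓜) (sym (Dmap-pre (𝓜⊆Ker v v∈𝓜))) v∈𝓜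

corollary3p3 : ∀ {m n q r} (A : Mat m n) (Gm : Mat n r) → IsKerBasis A Gm →
  (β : Fin n → Fin q) → IsBouquetLabelling A β →
  (c : Fin q → Vec ℤ n) → (∀ k → IsBouquetVector Gm β k (c k)) →
  (∀ u → InKer (bouquetMatrix A c) u → NonNeg u → u ≡ zeros) →
  ∀ u → Indispensable (bouquetMatrix A c) u → Indispensable A (Dmap c u)
corollary3p3 {n = n} A Gm kerBasis β labelling c bouquetVector _ u (u∈Ker , u-indispensable) =
  trans (·ᵥ-Dmap c A u) u∈Ker , λ 𝓜 (𝓜-basis , _) →
    decidable-stable (Dmap c u ∈? 𝓜 ⊎-dec neg (Dmap c u) ∈? 𝓜)
      (¬¬-map (±u∈pre𝓜⇒±Du∈𝓜 𝓜-basis)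
        (minimal-⊆-MarkovBasis (bouquetMatrix A c) (pullback-MarkovBasis 𝓜-basis)))
  where
  open Bouquets A Gm kerBasis β labelling c bouquetVector
  open DecMembership (≡-dec {n = n} ℤ._≟_) using (_∈?_)
  ±u∈pre𝓜⇒±Du∈𝓜 : ∀ {𝓜} → IsMarkovBasis A 𝓜 →
    ∃[ L₀ ] (L₀ ⊆ List.map pre 𝓜 × IsMinimalMarkovBasis (bouquetMatrix A c) L₀) →
    Dmap c u ∈ 𝓜 ⊎ neg (Dmap c u) ∈ 𝓜
  ±u∈pre𝓜⇒±Du∈𝓜 {𝓜} 𝓜-basis (L₀ , L₀⊆pre𝓜 , L₀-minimal) =
    [ inj₁ ∘ Dmap-∈ 𝓜-basis ∘ L₀⊆pre𝓜
    , inj₂ ∘ subst (_∈ 𝓜) (Dmap-neg c u) ∘ Dmap-∈ 𝓜-basis ∘ L₀⊆pre𝓜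
    ]
      (u-indispensable L₀ L₀-minimal)
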